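{- Let $n\ge 8$ and $D=(\mathcal V,\mathcal A)\in EX(n)$, with maximum out-degree $\Delta^+$. Then $$\alpha:=\max_{v\in\mathcal V,\ d^+(v)=\Delta^+}\ \max_{u\in\mathcal V} e\big(u,\mathcal V\setminus N^+(v)\big)\le 1,$$ i.e. for every vertex $v$ of maximum out-degree, every vertex of $D$ has at most one out-neighbour outside $N^+(v)$.
   Context: Digraphs are strict (no loops, no parallel arcs). $N^+(v)$ is the out-neighbourhood of $v$, $d^+(v)=|N^+(v)|$, and $e(u,S)$ is the number of arcs from $u$ to vertices of $S$. A digraph is $\mathscr{F}$-free if it does not contain two distinct walks of length 2 (sequences $u\to a\to w$ of arcs, $u=w$ allowed) with the same initial and terminal vertices. $ex(n)$ is the maximum number of arcs of an $\mathscr{F}$-free digraph on $n$ vertices, and $EX(n)$ is the set of $\mathscr{F}$-free digraphs on $n$ vertices with exactly $ex(n)$ arcs. -}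

module Defs where

open import Data.Nat using (ℕ; _+_; _≤_)
open import Data.Bool using (Bool; true; false; if_then_else_; _∧_; not)
open import Data.Fin using (Fin)
open import Data.List using (List; map; allFin)
open import Data.Nat.ListAction using (sum)
open import Data.Product using (_×_)
open import Relation.Binary.PropositionalEquality using (_≡_)

-- A Bool-valued relation has no
-- parallel arcs by construction; looplessness is imposed by IsStrict.
Digraph : ℕ → Set
Digraph n = Fin n → Fin n → Bool

IsStrict : ∀ {n} → Digraph n → Set
IsStrict {n} D = (v : Fin n) → D v v ≡ false

count : ∀ {n} → (Fin n → Bool) → ℕ
count {n} p = sum (map (λ w → if p w then 1 else 0) (allFin n))

outdeg : ∀ {n} → Digraph n → Fin n → ℕ
outdeg D v = count (D v)

arcs : ∀ {n} → Digraph n → ℕ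
arcs {n} D = sum (map (outdeg D) (allFin n))

eOutside : ∀ {n} → Digraph n → Fin n → Fin n → ℕ
eOutside D u v = count (λ w → D u w ∧ not (D v w))

-- F-free: two walks u → a → w and u → b → w of length 2 (u = w allowed)
-- with the same ends are equal, i.e. have the same middle vertex.
FFree : ∀ {n} → Digraph n → Set
FFree {n} D = (u a b w : Fin n) →
  D u a ≡ true → D a w ≡ true → D u b ≡ true → D b w ≡ true → a ≡ b

InEX : ∀ {n} → Digraph n → Set
InEX {n} D = IsStrict D × FFree D ×
  ((D' : Digraph n) → IsStrict D' → FFree D' → arcs D' ≤ arcs D)

MaxOutdeg : ∀ {n} → Digraph n → Fin n → Set
MaxOutdeg {n} D v = (w : Fin n) → outdeg D w ≤ outdeg D v

-- Write n = 2m + r with r ≤ 1.  A construction gives ex(n) ≥ m(m+r) + n − 1.  For a vertex x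
-- of maximum out-degree Δ, F-freeness bounds the total out-degree of N⁺(x) by n, whence
-- |A| + Σ_{a ∉ N⁺(x)} (Δ − d⁺(a)) ≤ n + (n − Δ)Δ = n + m(m+r) − i(i+r) for some i with
-- m ≤ Δ + i.  So the deficit sum of x is at most 1 − i(i+r).  If u had two out-neighbours
-- outside N⁺(v), both deficits would enter the deficit sum of v, so one of them, x, has
-- out-degree Δ and the other, y, out-degree at least Δ − 1.  F-freeness at u makes N⁺(y)
-- disjoint from N⁺(x), so d⁺(y)·Δ ≤ n + (deficit sum of x); together with m ≤ Δ + i and the
-- bound 1 − i(i+r) on both deficit sums this is impossible for m ≥ 4.
module Submission where

open import Defs
open import Data.Nat using (ℕ; zero; suc; _+_; _*_; _∸_; _≤_; _<_; z≤n; s≤s; s≤s⁻¹; _≤?_; _<?_; _≟_)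
open import Data.Nat.Properties
open import Data.Bool using (Bool; true; false; if_then_else_; _∧_; not)
open import Data.Fin using (Fin; zero; suc; toℕ; fromℕ<)
import Data.Fin.Properties as Fin
import Data.List as List using (map; tabulate)
import Data.Nat.ListAction as List
open import Data.Product using (_×_; _,_; proj₁; proj₂; ∃-syntax)
open import Data.Sum using (_⊎_; inj₁; inj₂)
open import Data.Empty using (⊥; ⊥-elim)
open import Function using (_∘_)
open import Relation.Nullary using (¬_; Dec; yes; no; does)
open import Relation.Nullary.Decidable using (dec-true; dec-false; _×-dec_; _⊎-dec_)
open import Relation.Binary.PropositionalEquality
open import Algebra.Properties.Semiring.Sum +-*-semiring
  using (sum; sum-syntax; ∑-distrib-+; ∑-comm; *-distribˡ-sum; *-distribʳ-sum; sum-cong-≗)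
open import Data.Nat.Tactic.RingSolver using (solve-∀)

𝟙 : Bool → ℕ
𝟙 b = if b then 1 else 0

𝟙-∧ : ∀ b c → 𝟙 (b ∧ c) ≡ 𝟙 b * 𝟙 c
𝟙-∧ true  c = sym (+-identityʳ (𝟙 c))
𝟙-∧ false c = refl

𝟙-not+𝟙 : ∀ b → 𝟙 (not b) + 𝟙 b ≡ 1
𝟙-not+𝟙 true  = refl
𝟙-not+𝟙 false = refl

∧-true⁻ : ∀ {b c} → b ∧ c ≡ true → b ≡ true × c ≡ true
∧-true⁻ {true} {true} _ = refl , refl

𝟙-split : ∀ b k → k ≡ 𝟙 b * k + 𝟙 (not b) * k
𝟙-split true  k = sym (trans (+-identityʳ _) (+-identityʳ k))
𝟙-split false k = sym (+-identityʳ k)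

not-true⁻ : ∀ {b} → not b ≡ true → b ≡ false
not-true⁻ {false} _ = refl

𝟙-does : ∀ {A : Set} (a? : Dec A) → A → 𝟙 (does a?) ≡ 1
𝟙-does a? a rewrite dec-true a? a = refl

witness : ∀ {A : Set} (a? : Dec A) → does a? ≡ true → A
witness (yes a) _ = a

sum-map-tabulate : ∀ {n} {A : Set} (f : A → ℕ) (g : Fin n → A) →
  List.sum (List.map f (List.tabulate g)) ≡ ∑[ i < n ] f (g i)
sum-map-tabulate {zero}  f g = refl
sum-map-tabulate {suc n} f g = cong (f (g zero) +_) (sum-map-tabulate f (λ i → g (suc i)))

∑-const : ∀ n c → ∑[ i < n ] c ≡ n * c
∑-const zero    c = refl
∑-const (suc n) c = cong (c +_) (∑-const n c)

∑-mono-≤ : ∀ {n} {f g : Fin n → ℕ} → (∀ i → f i ≤ g i) → sum f ≤ sum g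
∑-mono-≤ {zero}  f≤g = z≤n
∑-mono-≤ {suc n} f≤g = +-mono-≤ (f≤g zero) (∑-mono-≤ (λ i → f≤g (suc i)))

term-≤-∑ : ∀ {n} (f : Fin n → ℕ) i → f i ≤ sum f
term-≤-∑ f zero    = m≤m+n _ _
term-≤-∑ f (suc i) = ≤-trans (term-≤-∑ (λ j → f (suc j)) i) (m≤n+m _ _)

pair-≤-∑ : ∀ {n} (f : Fin n → ℕ) {i j} → i ≢ j → f i + f j ≤ sum f
pair-≤-∑ f {zero}  {zero}  i≢j = ⊥-elim (i≢j refl)
pair-≤-∑ f {zero}  {suc j} _   = +-monoʳ-≤ (f zero) (term-≤-∑ (λ k → f (suc k)) j)
pair-≤-∑ f {suc i} {zero}  _   = subst (_≤ sum f) (+-comm (f zero) (f (suc i)))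
  (+-monoʳ-≤ (f zero) (term-≤-∑ (λ k → f (suc k)) i))
pair-≤-∑ f {suc i} {suc j} i≢j =
  ≤-trans (pair-≤-∑ (λ k → f (suc k)) (λ i≡j → i≢j (cong suc i≡j))) (m≤n+m _ _)

∑-𝟙-≤1 : ∀ {n} (p : Fin n → Bool) →
  (∀ i j → p i ≡ true → p j ≡ true → i ≡ j) → ∑[ i < n ] 𝟙 (p i) ≤ 1
∑-𝟙-≤1 {zero}  p unique = z≤n
∑-𝟙-≤1 {suc n} p unique with p zero in p0
... | false = ∑-𝟙-≤1 (λ i → p (suc i)) (λ i j pi pj → Fin.suc-injective (unique _ _ pi pj))
... | true  = s≤s (≤-reflexive (trans (sum-cong-≗ rest≡0) (trans (∑-const n 0) (*-zeroʳ n))))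
  where
  rest≡0 : ∀ i → 𝟙 (p (suc i)) ≡ 0
  rest≡0 i with p (suc i) in pi
  ... | false = refl
  ... | true with () ← unique zero (suc i) p0 pi

∑< : ℕ → (ℕ → ℕ) → ℕ
∑< k f = ∑[ i < k ] f (toℕ i)

∑<-+ : ∀ a b f → ∑< (a + b) f ≡ ∑< a f + ∑< b (λ i → f (a + i))
∑<-+ zero    b f = refl
∑<-+ (suc a) b f = trans (cong (f 0 +_) (∑<-+ a b (λ i → f (suc i)))) (sym (+-assoc (f 0) _ _))

∑<-≤-+ : ∀ a b f → ∑< a f ≤ ∑< (a + b) f
∑<-≤-+ a b f = subst (∑< a f ≤_) (sym (∑<-+ a b f)) (m≤m+n _ _)

∑<-lower : ∀ k f {c} → (∀ i → i < k → c ≤ f i) → k * c ≤ ∑< k f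
∑<-lower k f {c} c≤f = subst (_≤ ∑< k f) (∑-const k c) (∑-mono-≤ (λ i → c≤f (toℕ i) (Fin.toℕ<n i)))

term-≤-∑< : ∀ {i k} f → i < k → f i ≤ ∑< k f
term-≤-∑< {k = k} f i<k =
  subst (λ j → f j ≤ ∑< k f) (Fin.toℕ-fromℕ< i<k) (term-≤-∑ (λ j → f (toℕ j)) (fromℕ< i<k))

walks₂ : ∀ {n} → Digraph n → Fin n → ℕ
walks₂ {n} D x = ∑[ a < n ] (𝟙 (D x a) * outdeg D a)

outdegᶜ : ∀ {n} → Digraph n → Fin n → ℕ
outdegᶜ {n} D x = ∑[ a < n ] 𝟙 (not (D x a))

-- Truncated subtraction is harmless: deficit is only used with Δ the maximum out-degree.
deficit : ∀ {n} → Digraph n → ℕ → Fin n → ℕ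
deficit {n} D Δ x = ∑[ a < n ] (𝟙 (not (D x a)) * (Δ ∸ outdeg D a))

module _ {n} (D : Digraph n) where

  outdeg≡∑ : ∀ x → outdeg D x ≡ ∑[ a < n ] 𝟙 (D x a)
  outdeg≡∑ x = sum-map-tabulate (λ a → 𝟙 (D x a)) (λ a → a)

  arcs≡∑ : arcs D ≡ ∑[ x < n ] outdeg D x
  arcs≡∑ = sum-map-tabulate (outdeg D) (λ x → x)

  eOutside≡∑ : ∀ u v → eOutside D u v ≡ ∑[ w < n ] 𝟙 (D u w ∧ not (D v w))
  eOutside≡∑ u v = sum-map-tabulate (λ w → 𝟙 (D u w ∧ not (D v w))) (λ w → w)

  outdegᶜ+outdeg : ∀ x → outdegᶜ D x + outdeg D x ≡ n
  outdegᶜ+outdeg x = begin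
    outdegᶜ D x + outdeg D x                   ≡⟨ cong (outdegᶜ D x +_) (outdeg≡∑ x) ⟩
    outdegᶜ D x + ∑[ a < n ] 𝟙 (D x a)          ≡⟨ ∑-distrib-+ (λ a → 𝟙 (not (D x a))) _ ⟨
    ∑[ a < n ] (𝟙 (not (D x a)) + 𝟙 (D x a))    ≡⟨ sum-cong-≗ (λ a → 𝟙-not+𝟙 (D x a)) ⟩
    ∑[ a < n ] 1                                ≡⟨ ∑-const n 1 ⟩
    n * 1                                       ≡⟨ *-identityʳ n ⟩
    n                                           ∎
    where open ≡-Reasoning

  ∑-𝟙*-split : ∀ {Δ} → (∀ a → outdeg D a ≤ Δ) → (p : Fin n → Bool) →
    ∑[ a < n ] (𝟙 (p a) * Δ) ≡
    ∑[ a < n ] (𝟙 (p a) * outdeg D a) + ∑[ a < n ] (𝟙 (p a) * (Δ ∸ outdeg D a))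
  ∑-𝟙*-split {Δ} max p = begin
    ∑[ a < n ] (𝟙 (p a) * Δ)
      ≡⟨ sum-cong-≗ (λ a → cong (𝟙 (p a) *_) (m+[n∸m]≡n (max a))) ⟨
    ∑[ a < n ] (𝟙 (p a) * (outdeg D a + (Δ ∸ outdeg D a)))
      ≡⟨ sum-cong-≗ (λ a → *-distribˡ-+ (𝟙 (p a)) (outdeg D a) _) ⟩
    ∑[ a < n ] (𝟙 (p a) * outdeg D a + 𝟙 (p a) * (Δ ∸ outdeg D a))
      ≡⟨ ∑-distrib-+ (λ a → 𝟙 (p a) * outdeg D a) _ ⟩
    ∑[ a < n ] (𝟙 (p a) * outdeg D a) + ∑[ a < n ] (𝟙 (p a) * (Δ ∸ outdeg D a)) ∎
    where open ≡-Reasoning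

  deficit-pair-≤ : ∀ {Δ v w₁ w₂} → w₁ ≢ w₂ → D v w₁ ≡ false → D v w₂ ≡ false →
    (Δ ∸ outdeg D w₁) + (Δ ∸ outdeg D w₂) ≤ deficit D Δ v
  deficit-pair-≤ {Δ} {v} {w₁} {w₂} w₁≢w₂ vw₁ vw₂ =
    subst (_≤ deficit D Δ v) (cong₂ _+_ (weight vw₁) (weight vw₂))
      (pair-≤-∑ (λ a → 𝟙 (not (D v a)) * (Δ ∸ outdeg D a)) w₁≢w₂)
    where
    weight : ∀ {w} → D v w ≡ false → 𝟙 (not (D v w)) * (Δ ∸ outdeg D w) ≡ Δ ∸ outdeg D w
    weight vw rewrite vw = +-identityʳ _

  module _ (F-free : FFree D) where

    outNbrs-disjoint : ∀ {u w₁ w₂} → w₁ ≢ w₂ → D u w₁ ≡ true → D u w₂ ≡ true →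
      ∀ z → D w₂ z ≡ true → D w₁ z ≡ false
    outNbrs-disjoint {u} {w₁} {w₂} w₁≢w₂ uw₁ uw₂ z w₂z with D w₁ z in w₁z
    ... | false = refl
    ... | true  = ⊥-elim (w₁≢w₂ (F-free u w₁ w₂ z uw₁ w₁z uw₂ w₂z))

    walks₂-≤ : ∀ x → walks₂ D x ≤ n
    walks₂-≤ x = begin
      ∑[ a < n ] (𝟙 (D x a) * outdeg D a)
        ≡⟨ sum-cong-≗ (λ a → cong (𝟙 (D x a) *_) (outdeg≡∑ a)) ⟩
      ∑[ a < n ] (𝟙 (D x a) * ∑[ w < n ] 𝟙 (D a w))
        ≡⟨ sum-cong-≗ (λ a → *-distribˡ-sum (𝟙 (D x a)) (λ w → 𝟙 (D a w))) ⟩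
      ∑[ a < n ] ∑[ w < n ] (𝟙 (D x a) * 𝟙 (D a w))
        ≡⟨ sum-cong-≗ (λ a → sum-cong-≗ (λ w → 𝟙-∧ (D x a) (D a w))) ⟨
      ∑[ a < n ] ∑[ w < n ] 𝟙 (D x a ∧ D a w)
        ≡⟨ ∑-comm (λ a w → 𝟙 (D x a ∧ D a w)) ⟩
      ∑[ w < n ] ∑[ a < n ] 𝟙 (D x a ∧ D a w)
        ≤⟨ ∑-mono-≤ (λ w → ∑-𝟙-≤1 (λ a → D x a ∧ D a w) (middle-unique w)) ⟩
      ∑[ w < n ] 1
        ≡⟨ trans (∑-const n 1) (*-identityʳ n) ⟩
      n ∎
      where
      open ≤-Reasoning
      middle-unique : ∀ w a b → D x a ∧ D a w ≡ true → D x b ∧ D b w ≡ true → a ≡ b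
      middle-unique w a b xaw xbw with ∧-true⁻ xaw | ∧-true⁻ xbw
      ... | xa , aw | xb , bw = F-free x a b w xa aw xb bw

    arcs+deficit-≤ : ∀ {Δ} → (∀ a → outdeg D a ≤ Δ) → ∀ x →
      arcs D + deficit D Δ x ≤ n + outdegᶜ D x * Δ
    arcs+deficit-≤ {Δ} max x = begin
      arcs D + deficit D Δ x
        ≡⟨ cong (_+ deficit D Δ x) (trans arcs≡∑ (sum-cong-≗ (λ a → 𝟙-split (D x a) (outdeg D a)))) ⟩
      ∑[ a < n ] (𝟙 (D x a) * outdeg D a + 𝟙 (not (D x a)) * outdeg D a) + deficit D Δ x
        ≡⟨ cong (_+ deficit D Δ x) (∑-distrib-+ (λ a → 𝟙 (D x a) * outdeg D a) _) ⟩
      walks₂ D x + outsideDegrees + deficit D Δ x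
        ≡⟨ +-assoc (walks₂ D x) _ _ ⟩
      walks₂ D x + (outsideDegrees + deficit D Δ x)
        ≤⟨ +-monoˡ-≤ _ (walks₂-≤ x) ⟩
      n + (outsideDegrees + deficit D Δ x)
        ≡⟨ cong (n +_) outside≡ ⟩
      n + outdegᶜ D x * Δ ∎
      where
      open ≤-Reasoning
      outsideDegrees : ℕ
      outsideDegrees = ∑[ a < n ] (𝟙 (not (D x a)) * outdeg D a)
      outside≡ : outsideDegrees + deficit D Δ x ≡ outdegᶜ D x * Δ
      outside≡ = trans (sym (∑-𝟙*-split max (λ a → not (D x a))))
                       (sym (*-distribʳ-sum Δ (λ a → 𝟙 (not (D x a)))))

    outdeg*Δ-≤ : ∀ {Δ} → (∀ a → outdeg D a ≤ Δ) → ∀ x y →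
      (∀ z → D y z ≡ true → D x z ≡ false) → outdeg D y * Δ ≤ n + deficit D Δ x
    outdeg*Δ-≤ {Δ} max x y disjoint = begin
      outdeg D y * Δ
        ≡⟨ cong (_* Δ) (outdeg≡∑ y) ⟩
      (∑[ a < n ] 𝟙 (D y a)) * Δ
        ≡⟨ *-distribʳ-sum Δ (λ a → 𝟙 (D y a)) ⟩
      ∑[ a < n ] (𝟙 (D y a) * Δ)
        ≡⟨ ∑-𝟙*-split max (D y) ⟩
      walks₂ D y + ∑[ a < n ] (𝟙 (D y a) * (Δ ∸ outdeg D a))
        ≤⟨ +-mono-≤ (walks₂-≤ y) (∑-mono-≤ outside-x) ⟩
      n + deficit D Δ x ∎
      where
      open ≤-Reasoning
      outside-x : ∀ a → 𝟙 (D y a) * (Δ ∸ outdeg D a) ≤ 𝟙 (not (D x a)) * (Δ ∸ outdeg D a)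
      outside-x a with D y a in ya
      ... | false = z≤n
      ... | true rewrite disjoint a ya = ≤-refl

stepLow : ℕ → ℕ
stepLow zero    = 1
stepLow (suc _) = 0

stepLow-≤1 : ∀ a → stepLow a ≤ 1
stepLow-≤1 zero    = ≤-refl
stepLow-≤1 (suc a) = z≤n

-- Vertices 0, …, m are low, the others high.  Every low vertex points to every high one, and
-- each vertex has at most one low out-neighbour: 1 for 0, 0 for the other low vertices, and
-- a + 1 − m for a high vertex a
-- whenever that is low.  For n = 2m + r this gives m(m+r) + n − 1 arcs.
Arc : ℕ → ℕ → ℕ → Set
Arc m a b = (a ≤ m × m < b) ⊎ (a ≤ m × b ≡ stepLow a) ⊎ (m < a × b ≤ m × b + m ≡ suc a)

arc? : ∀ m a b → Dec (Arc m a b)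
arc? m a b = (a ≤? m ×-dec m <? b)
  ⊎-dec (a ≤? m ×-dec b ≟ stepLow a)
  ⊎-dec (m <? a ×-dec b ≤? m ×-dec b + m ≟ suc a)

extremal : ∀ n → ℕ → Digraph n
extremal n m u w = does (arc? m (toℕ u) (toℕ w))

module _ {m : ℕ} where

  arc-from-high : ∀ {a b} → Arc m a b → m < a → b ≤ m × b + m ≡ suc a
  arc-from-high (inj₁ (a≤m , _))                m<a = ⊥-elim (<⇒≱ m<a a≤m)
  arc-from-high (inj₂ (inj₁ (a≤m , _)))         m<a = ⊥-elim (<⇒≱ m<a a≤m)
  arc-from-high (inj₂ (inj₂ (_ , b≤m , b+m≡1+a))) _ = b≤m , b+m≡1+a

  arc-low-to-low : ∀ {a b} → Arc m a b → a ≤ m → b ≤ m → b ≤ 1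
  arc-low-to-low (inj₁ (_ , m<b))             _   b≤m = ⊥-elim (<⇒≱ m<b b≤m)
  arc-low-to-low {a} (inj₂ (inj₁ (_ , refl)))  _   _   = stepLow-≤1 a
  arc-low-to-low (inj₂ (inj₂ (m<a , _)))      a≤m _   = ⊥-elim (<⇒≱ m<a a≤m)

  low-outNbr-unique : ∀ {u a b} → Arc m u a → Arc m u b → a ≤ m → b ≤ m → a ≡ b
  low-outNbr-unique (inj₁ (_ , m<a)) _ a≤m _ = ⊥-elim (<⇒≱ m<a a≤m)
  low-outNbr-unique _ (inj₁ (_ , m<b)) _ b≤m = ⊥-elim (<⇒≱ m<b b≤m)
  low-outNbr-unique (inj₂ (inj₁ (_ , refl))) (inj₂ (inj₁ (_ , refl))) _ _ = refl
  low-outNbr-unique (inj₂ (inj₁ (u≤m , _))) (inj₂ (inj₂ (m<u , _))) _ _ = ⊥-elim (<⇒≱ m<u u≤m)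
  low-outNbr-unique (inj₂ (inj₂ (m<u , _))) (inj₂ (inj₁ (u≤m , _))) _ _ = ⊥-elim (<⇒≱ m<u u≤m)
  low-outNbr-unique {a = a} {b} (inj₂ (inj₂ (_ , _ , a+m≡1+u))) (inj₂ (inj₂ (_ , _ , b+m≡1+u))) _ _ =
    +-cancelʳ-≡ m a b (trans a+m≡1+u (sym b+m≡1+u))

  high-inNbr-unique : ∀ {a b w} → Arc m a w → Arc m b w → m < a → m < b → a ≡ b
  high-inNbr-unique aw bw m<a m<b =
    suc-injective (trans (sym (proj₂ (arc-from-high aw m<a))) (proj₂ (arc-from-high bw m<b)))

  no-low-and-high-inNbr : ∀ {a b w} → Arc m a w → Arc m b w → a ≤ m → m < b → ⊥
  no-low-and-high-inNbr aw bw a≤m m<b with arc-from-high bw m<b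
  ... | w≤m , w+m≡1+b = <⇒≱ (s≤s m<b)
    (subst (_≤ suc m) w+m≡1+b (+-monoˡ-≤ m (arc-low-to-low aw a≤m w≤m)))

  arc-FFree : ∀ {u a b w} → Arc m u a → Arc m a w → Arc m u b → Arc m b w → a ≡ b
  arc-FFree {a = a} {b} ua aw ub bw with a ≤? m | b ≤? m
  ... | yes a≤m | yes b≤m = low-outNbr-unique ua ub a≤m b≤m
  ... | no  a≰m | no  b≰m = high-inNbr-unique aw bw (≰⇒> a≰m) (≰⇒> b≰m)
  ... | yes a≤m | no  b≰m = ⊥-elim (no-low-and-high-inNbr aw bw a≤m (≰⇒> b≰m))
  ... | no  a≰m | yes b≤m = ⊥-elim (no-low-and-high-inNbr bw aw b≤m (≰⇒> a≰m))

  arc-irreflexive : ∀ {a} → ¬ Arc m a a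
  arc-irreflexive (inj₁ (a≤m , m<a))                 = <⇒≱ m<a a≤m
  arc-irreflexive {zero}  (inj₂ (inj₁ (_ , ())))
  arc-irreflexive {suc a} (inj₂ (inj₁ (_ , ())))
  arc-irreflexive (inj₂ (inj₂ (m<a , a≤m , _)))      = <⇒≱ m<a a≤m

extremal-strict : ∀ n m → IsStrict (extremal n m)
extremal-strict n m v = dec-false (arc? m (toℕ v) (toℕ v)) arc-irreflexive

extremal-FFree : ∀ n m → FFree (extremal n m)
extremal-FFree n m u a b w ua aw ub bw =
  Fin.toℕ-injective (arc-FFree (arc u a ua) (arc a w aw) (arc u b ub) (arc b w bw))
  where
  arc : ∀ x y → extremal n m x y ≡ true → Arc m (toℕ x) (toℕ y)
  arc x y = witness (arc? m (toℕ x) (toℕ y))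

module ExtremalCount (p r : ℕ) where

  m n : ℕ
  m = suc p
  n = m + m + r

  row : ℕ → ℕ
  row a = ∑< n (λ b → 𝟙 (does (arc? m a b)))

  n≡1+m+[p+r] : n ≡ suc m + (p + r)
  n≡1+m+[p+r] = rearrange p r
    where
    rearrange : ∀ p r → suc p + suc p + r ≡ suc (suc p) + (p + r)
    rearrange = solve-∀

  low-row : ∀ a → a ≤ m → m + r ≤ row a
  low-row a a≤m = begin
    m + r
      ≡⟨ cong suc (*-identityʳ (p + r)) ⟨
    1 + (p + r) * 1
      ≤⟨ +-mono-≤ toStepLow (∑<-lower (p + r) (λ i → R (suc m + i)) toHigh) ⟩
    ∑< (suc m) R + ∑< (p + r) (λ i → R (suc m + i))
      ≡⟨ ∑<-+ (suc m) (p + r) R ⟨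
    ∑< (suc m + (p + r)) R
      ≡⟨ cong (λ k → ∑< k R) n≡1+m+[p+r] ⟨
    row a ∎
    where
    open ≤-Reasoning
    R : ℕ → ℕ
    R b = 𝟙 (does (arc? m a b))
    toStepLow : 1 ≤ ∑< (suc m) R
    toStepLow = subst (_≤ ∑< (suc m) R) (𝟙-does (arc? m a (stepLow a)) (inj₂ (inj₁ (a≤m , refl))))
      (term-≤-∑< {stepLow a} {suc m} R (s≤s (≤-trans (stepLow-≤1 a) (s≤s z≤n))))
    toHigh : ∀ i → i < p + r → 1 ≤ R (suc m + i)
    toHigh i _ = ≤-reflexive (sym (𝟙-does (arc? m a (suc m + i)) (inj₁ (a≤m , s≤s (m≤m+n m i)))))

  high-row : ∀ j → j < p → 1 ≤ row (suc m + j)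
  high-row j j<p = subst (_≤ row (suc m + j)) (𝟙-does (arc? m (suc m + j) (suc (suc j))) step)
    (term-≤-∑< (λ b → 𝟙 (does (arc? m (suc m + j) b))) 2+j<n)
    where
    rearrange : ∀ j m → suc (suc j) + m ≡ suc (suc m + j)
    rearrange = solve-∀
    step : Arc m (suc m + j) (suc (suc j))
    step = inj₂ (inj₂ (s≤s (m≤m+n m j) , s≤s j<p , rearrange j m))
    2+j<n : suc (suc j) < n
    2+j<n = ≤-trans (s≤s (s≤s j<p)) (≤-trans (s≤s (m≤n+m m p)) (m≤m+n (m + m) r))

  rows-≥ : suc m * (m + r) + p * 1 ≤ ∑< n row
  rows-≥ = begin
    suc m * (m + r) + p * 1
      ≤⟨ +-mono-≤ (∑<-lower (suc m) row (λ a a<1+m → low-row a (s≤s⁻¹ a<1+m)))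
                  (≤-trans (∑<-lower p (λ j → row (suc m + j)) high-row) (∑<-≤-+ p r (λ j → row (suc m + j)))) ⟩
    ∑< (suc m) row + ∑< (p + r) (λ j → row (suc m + j))
      ≡⟨ ∑<-+ (suc m) (p + r) row ⟨
    ∑< (suc m + (p + r)) row
      ≡⟨ cong (λ k → ∑< k row) n≡1+m+[p+r] ⟨
    ∑< n row ∎
    where open ≤-Reasoning

  extremal-arcs-≥ : m * (m + r) + n ≤ suc (arcs (extremal n m))
  extremal-arcs-≥ = begin
    m * (m + r) + n              ≡⟨ rearrange p r ⟩
    suc (suc m * (m + r) + p * 1) ≤⟨ s≤s rows-≥ ⟩
    suc (∑< n row)               ≡⟨ cong suc (sum-cong-≗ (λ u → outdeg≡∑ (extremal n m) u)) ⟨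
    suc (∑[ u < n ] outdeg (extremal n m) u) ≡⟨ cong suc (arcs≡∑ (extremal n m)) ⟨
    suc (arcs (extremal n m))    ∎
    where
    open ≤-Reasoning
    rearrange : ∀ p r → suc p * (suc p + r) + (suc p + suc p + r) ≡ suc (suc (suc p) * (suc p + r) + p * 1)
    rearrange = solve-∀

product-defect : ∀ {c Δ} m r → r ≤ 1 → c + Δ ≡ m + m + r →
  ∃[ i ] c * Δ + i * (i + r) ≡ m * (m + r) × m ≤ Δ + i
product-defect {c} {Δ} m r r≤1 c+Δ≡n with m + r ≤? Δ
... | yes m+r≤Δ with m≤n⇒∃[o]m+o≡n m+r≤Δ
...   | i , refl =
  i , subst (λ m → c * (m + r + i) + i * (i + r) ≡ m * (m + r)) c+i≡m (identity c i r) ,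
  ≤-trans (m≤m+n m r) (≤-trans (m≤m+n (m + r) i) (m≤m+n _ i))
  where
  identity : ∀ c i r → c * ((c + i) + r + i) + i * (i + r) ≡ (c + i) * ((c + i) + r)
  identity = solve-∀
  rearrange : ∀ c i m r → c + (m + r + i) ≡ (c + i) + (m + r)
  rearrange = solve-∀
  c+i≡m : c + i ≡ m
  c+i≡m = +-cancelʳ-≡ (m + r) (c + i) m
    (trans (sym (rearrange c i m r)) (trans c+Δ≡n (+-assoc m m r)))
product-defect {c} {Δ} m r r≤1 c+Δ≡n | no m+r≰Δ with m≤n⇒∃[o]m+o≡n Δ≤m
  where
  Δ≤m : Δ ≤ m
  Δ≤m = s≤s⁻¹ (≤-trans (≰⇒> m+r≰Δ) (subst (m + r ≤_) (+-comm m 1) (+-monoʳ-≤ m r≤1)))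
...   | i , refl = i , subst (λ c → c * Δ + i * (i + r) ≡ (Δ + i) * ((Δ + i) + r)) (sym c≡) (identity Δ i r) , ≤-refl
  where
  identity : ∀ Δ i r → (Δ + i + i + r) * Δ + i * (i + r) ≡ (Δ + i) * ((Δ + i) + r)
  identity = solve-∀
  rearrange : ∀ Δ i r → (Δ + i) + (Δ + i) + r ≡ (Δ + i + i + r) + Δ
  rearrange = solve-∀
  c≡ : c ≡ Δ + i + i + r
  c≡ = +-cancelʳ-≡ Δ c _ (trans c+Δ≡n (rearrange Δ i r))

excess-≤1 : ∀ {A B c n ii q} → B + n ≤ suc A → A + q ≤ n + c → c + ii ≡ B → ii + q ≤ 1
excess-≤1 {A} {B} {c} {n} {ii} {q} lower upper c+ii≡B = +-cancelˡ-≤ (B + n) (ii + q) 1 (begin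
  B + n + (ii + q)        ≤⟨ +-monoˡ-≤ (ii + q) lower ⟩
  suc A + (ii + q)        ≡⟨ cong suc (rearrange A ii q) ⟩
  suc (A + q + ii)        ≤⟨ s≤s (+-monoˡ-≤ ii upper) ⟩
  suc (n + c + ii)        ≡⟨ cong suc (trans (+-assoc n c ii) (cong (n +_) c+ii≡B)) ⟩
  suc (n + B)             ≡⟨ cong suc (+-comm n B) ⟩
  suc (B + n)             ≡⟨ +-comm 1 (B + n) ⟩
  B + n + 1               ∎)
  where
  open ≤-Reasoning
  rearrange : ∀ A ii q → A + (ii + q) ≡ A + q + ii
  rearrange = solve-∀

small-defect : ∀ i r q → r ≤ 1 → i * (i + r) + q ≤ 1 → i + q ≤ 1 × 3 * i + (r + q) ≤ 3
small-defect zero          r q r≤1 q≤1 = q≤1 , ≤-trans (+-mono-≤ r≤1 q≤1) (s≤s (s≤s z≤n))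
small-defect (suc zero)    zero    zero    _ _        = ≤-refl , ≤-refl
small-defect (suc zero)    zero    (suc q) _ (s≤s ())
small-defect (suc zero)    (suc r) q       _ (s≤s ())
small-defect (suc (suc i)) r q r≤1 (s≤s ())

degree-contradiction : ∀ {m r i q q′ Δ d} → 4 ≤ m → r ≤ 1 →
  i * (i + r) + q ≤ 1 → i * (i + r) + q′ ≤ 1 →
  m ≤ Δ + i → Δ ≤ d + q → d * Δ ≤ m + m + r + q′ → ⊥
degree-contradiction {m} {r} {i} {q} {q′} {Δ} {d} 4≤m r≤1 defect defect′ m≤Δ+i Δ≤d+q dΔ≤ =
  <⇒≱ 4≤m (+-cancelˡ-≤ (m + m) m 3 (begin
    m + m + m             ≡⟨ triple m ⟩
    3 * m                 ≤⟨ *-monoʳ-≤ 3 m≤Δ+i ⟩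
    3 * (Δ + i)           ≡⟨ *-distribˡ-+ 3 Δ i ⟩
    3 * Δ + 3 * i         ≤⟨ +-monoˡ-≤ (3 * i) (*-monoˡ-≤ Δ 3≤d) ⟩
    d * Δ + 3 * i         ≤⟨ +-monoˡ-≤ (3 * i) dΔ≤ ⟩
    m + m + r + q′ + 3 * i ≡⟨ rearrange m r q′ (3 * i) ⟩
    m + m + (3 * i + (r + q′)) ≤⟨ +-monoʳ-≤ (m + m) (proj₂ (small-defect i r q′ r≤1 defect′)) ⟩
    m + m + 3             ∎))
  where
  open ≤-Reasoning
  triple : ∀ m → m + m + m ≡ 3 * m
  triple = solve-∀
  rearrange : ∀ m r q k → m + m + r + q + k ≡ m + m + (k + (r + q))
  rearrange = solve-∀
  3≤d : 3 ≤ d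
  3≤d = s≤s⁻¹ (begin
    4             ≤⟨ 4≤m ⟩
    m             ≤⟨ m≤Δ+i ⟩
    Δ + i         ≤⟨ +-monoˡ-≤ i Δ≤d+q ⟩
    d + q + i     ≡⟨ trans (+-assoc d q i) (cong (d +_) (+-comm q i)) ⟩
    d + (i + q)   ≤⟨ +-monoʳ-≤ d (proj₁ (small-defect i r q r≤1 defect)) ⟩
    d + 1         ≡⟨ +-comm d 1 ⟩
    suc d         ∎)

EX-arcs-≥ : ∀ {m} r → 1 ≤ m → (D : Digraph (m + m + r)) → InEX D →
  m * (m + r) + (m + m + r) ≤ suc (arcs D)
EX-arcs-≥ {suc p} r _ D (_ , _ , maximal) = ≤-trans extremal-arcs-≥
  (s≤s (maximal (extremal n m) (extremal-strict n m) (extremal-FFree n m)))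
  where open ExtremalCount p r

module MaximumOutdegree {m r : ℕ} (4≤m : 4 ≤ m) (r≤1 : r ≤ 1)
  {D : Digraph (m + m + r)} (D∈EX : InEX D) {v} (v-max : MaxOutdeg D v) where

  Δ : ℕ
  Δ = outdeg D v

  F-free : FFree D
  F-free = proj₁ (proj₂ D∈EX)

  defect : ∃[ i ] outdegᶜ D v * Δ + i * (i + r) ≡ m * (m + r) × m ≤ Δ + i
  defect = product-defect m r r≤1 (outdegᶜ+outdeg D v)

  i : ℕ
  i = proj₁ defect

  max-vertex-defect : ∀ x → outdeg D x ≡ Δ → i * (i + r) + deficit D Δ x ≤ 1
  max-vertex-defect x dx≡Δ = excess-≤1
    (EX-arcs-≥ r (≤-trans (s≤s z≤n) 4≤m) D D∈EX)
    (arcs+deficit-≤ D F-free v-max x)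
    (subst (λ c → c * Δ + i * (i + r) ≡ m * (m + r)) (sym same-outdegᶜ) (proj₁ (proj₂ defect)))
    where
    same-outdegᶜ : outdegᶜ D x ≡ outdegᶜ D v
    same-outdegᶜ = +-cancelʳ-≡ Δ _ _
      (trans (cong (outdegᶜ D x +_) (sym dx≡Δ)) (trans (outdegᶜ+outdeg D x) (sym (outdegᶜ+outdeg D v))))

  full-and-disjoint-⊥ : ∀ x y → outdeg D x ≡ Δ → (∀ z → D y z ≡ true → D x z ≡ false) →
    Δ ∸ outdeg D y ≤ deficit D Δ v → ⊥
  full-and-disjoint-⊥ x y dx≡Δ disjoint deficit-y≤ = degree-contradiction 4≤m r≤1
    (max-vertex-defect v refl) (max-vertex-defect x dx≡Δ) (proj₂ (proj₂ defect))
    (≤-trans (≤-reflexive (sym (m+[n∸m]≡n (v-max y)))) (+-monoʳ-≤ (outdeg D y) deficit-y≤))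
    (outdeg*Δ-≤ D F-free v-max x y disjoint)

  -- The two deficits sum to at most deficit D Δ v ≤ 1, so one of w₁, w₂ has out-degree Δ.
  two-outside-⊥ : ∀ {u w₁ w₂} → w₁ ≢ w₂ → D u w₁ ≡ true → D v w₁ ≡ false →
    D u w₂ ≡ true → D v w₂ ≡ false → ⊥
  two-outside-⊥ {w₁ = w₁} {w₂} w₁≢w₂ uw₁ vw₁ uw₂ vw₂
    with deficit-pair-≤ D w₁≢w₂ vw₁ vw₂ | Δ ≤? outdeg D w₁
  ... | pair≤ | yes Δ≤d₁ = full-and-disjoint-⊥ w₁ w₂ (≤-antisym (v-max w₁) Δ≤d₁)
    (outNbrs-disjoint D F-free w₁≢w₂ uw₁ uw₂) (≤-trans (m≤n+m _ _) pair≤)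
  ... | pair≤ | no  Δ≰d₁ = full-and-disjoint-⊥ w₂ w₁ (≤-antisym (v-max w₂) (m∸n≡0⇒m≤n t₂≡0))
    (outNbrs-disjoint D F-free (w₁≢w₂ ∘ sym) uw₂ uw₁) (≤-trans (m≤m+n _ _) pair≤)
    where
    t₂≡0 : Δ ∸ outdeg D w₂ ≡ 0
    t₂≡0 = n≤0⇒n≡0 (s≤s⁻¹ (begin
      suc (Δ ∸ outdeg D w₂)                      ≤⟨ +-monoˡ-≤ _ (m<n⇒0<n∸m (≰⇒> Δ≰d₁)) ⟩
      (Δ ∸ outdeg D w₁) + (Δ ∸ outdeg D w₂)      ≤⟨ pair≤ ⟩
      deficit D Δ v                              ≤⟨ m≤n+m _ _ ⟩
      i * (i + r) + deficit D Δ v                ≤⟨ max-vertex-defect v refl ⟩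
      1                                          ∎))
      where open ≤-Reasoning

  eOutside-≤1 : ∀ u → eOutside D u v ≤ 1
  eOutside-≤1 u = subst (_≤ 1) (sym (eOutside≡∑ D u v)) (∑-𝟙-≤1 _ unique)
    where
    unique : ∀ w₁ w₂ → D u w₁ ∧ not (D v w₁) ≡ true → D u w₂ ∧ not (D v w₂) ≡ true → w₁ ≡ w₂
    unique w₁ w₂ h₁ h₂ with w₁ Fin.≟ w₂ | ∧-true⁻ h₁ | ∧-true⁻ h₂
    ... | yes w₁≡w₂ | _ | _ = w₁≡w₂
    ... | no  w₁≢w₂ | uw₁ , vw₁ | uw₂ , vw₂ =
      ⊥-elim (two-outside-⊥ w₁≢w₂ uw₁ (not-true⁻ vw₁) uw₂ (not-true⁻ vw₂))

halve : ∀ n → ∃[ m ] ∃[ r ] r ≤ 1 × n ≡ m + m + r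
halve zero          = 0 , 0 , z≤n , refl
halve (suc zero)    = 0 , 1 , ≤-refl , refl
halve (suc (suc n)) with halve n
... | m , r , r≤1 , refl = suc m , r , r≤1 , cong suc (cong (_+ r) (sym (+-suc m m)))

half-≥4 : ∀ {m r} → r ≤ 1 → 8 ≤ m + m + r → 4 ≤ m
half-≥4 {m} {r} r≤1 8≤n = ≮⇒≥ λ m<4 →
  <⇒≱ (s≤s (+-mono-≤ (+-mono-≤ (s≤s⁻¹ m<4) (s≤s⁻¹ m<4)) r≤1)) 8≤n

lemma5 : (n : ℕ) → 8 ≤ n → (D : Digraph n) → InEX D →
    (v : Fin n) → MaxOutdeg D v → (u : Fin n) → eOutside D u v ≤ 1
lemma5 n 8≤n D D∈EX v v-max with halve n
... | m , r , r≤1 , refl = MaximumOutdegree.eOutside-≤1 {m} (half-≥4 r≤1 8≤n) r≤1 D∈EX v-max
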